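{- Assume the following Conjecture holds: for every positive integer $n$ and every system $T\subseteq\{x_i+1=x_k,\ x_i\cdot x_j=x_k:\ i,j,k\in\{1,\ldots,n\}\}$ which has only finitely many solutions in positive integers $x_1,\ldots,x_n$, each such solution satisfies $x_1,\ldots,x_n\leqslant f(n)$. Then there is an algorithm which, given any polynomial $D(x_1,\ldots,x_p)$ with integer coefficients such that the equation $D(x_1,\ldots,x_p)=0$ has only finitely many solutions in non-negative integers, computes an integer that bounds from above all entries of all these solutions.
   Context: Define $f:\mathbb{N}\setminus\{0\}\to\mathbb{N}\setminus\{0\}$ by $f(1)=1$, $f(n)=2^{2^{n-2}}$ for $n\in\{2,3,4,5\}$, and $f(n)=\left(2+2^{2^{n-4}}\right)^{2^{n-4}}$ for $n\geqslant 6$. -}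

module Defs where

open import Data.Nat using (ℕ; zero; suc; _+_; _*_; _^_; _≤_; _∸_)
open import Data.Integer as ℤ using (ℤ; +_)
open import Data.Fin using (Fin)
open import Data.Vec using (Vec; lookup)
open import Data.List using (List)
open import Data.List.Relation.Unary.All using (All)
open import Data.List.Membership.Propositional using (_∈_)
open import Data.Product using (Σ; _×_)
open import Relation.Binary.PropositionalEquality using (_≡_)

-- The function f (f 0 is an irrelevant dummy value; f is only used for n ≥ 1).
f : ℕ → ℕ
f 0 = 1
f 1 = 1
f 2 = 2 ^ (2 ^ 0)
f 3 = 2 ^ (2 ^ 1)
f 4 = 2 ^ (2 ^ 2)
f 5 = 2 ^ (2 ^ 3)
f n@(suc (suc (suc (suc (suc (suc _)))))) =
  (2 + 2 ^ (2 ^ (n ∸ 4))) ^ (2 ^ (n ∸ 4))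

data Eqn (n : ℕ) : Set where
  plus1 : (i k : Fin n) → Eqn n
  times : (i j k : Fin n) → Eqn n

Holds : {n : ℕ} → Vec ℕ n → Eqn n → Set
Holds x (plus1 i k)   = lookup x i + 1 ≡ lookup x k
Holds x (times i j k) = lookup x i * lookup x j ≡ lookup x k

PosSolution : {n : ℕ} → List (Eqn n) → Vec ℕ n → Set
PosSolution {n} T x = ((i : Fin n) → 1 ≤ lookup x i) × All (Holds x) T

FinitelyMany : {n : ℕ} → (Vec ℕ n → Set) → Set
FinitelyMany {n} P = Σ (List (Vec ℕ n)) λ L → (x : Vec ℕ n) → P x → x ∈ L

Conjecture : Set
Conjecture =
  (n : ℕ) → 1 ≤ n → (T : List (Eqn n)) →
  FinitelyMany (PosSolution T) →
  (x : Vec ℕ n) → PosSolution T x → (i : Fin n) → lookup x i ≤ f n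

data Poly (p : ℕ) : Set where
  const : ℤ → Poly p
  var   : Fin p → Poly p
  _⊕_   : Poly p → Poly p → Poly p
  _⊗_   : Poly p → Poly p → Poly p

eval : {p : ℕ} → Poly p → Vec ℕ p → ℤ
eval (const c) x = c
eval (var i)   x = + (lookup x i)
eval (a ⊕ b)   x = eval a x ℤ.+ eval b x
eval (a ⊗ b)   x = eval a x ℤ.* eval b x

Root : {p : ℕ} → Poly p → Vec ℕ p → Set
Root D x = eval D x ≡ + 0

module Submission where

-- Write D = P − Q where P and Q are built from 1 and the x_i + 1 by + and ·. With one variable
-- for 1, one for each x_i + 1 and auxiliary variables for the subterms, P = Q becomes a system of
-- equations x_i + 1 = x_k and x_i · x_j = x_k; addition is expressible because for z ≥ 1,
-- z = u + v exactly when (uz + 1)(vz + 1) = z²(uv + 1) + 1. The positive solutions of the system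
-- are in bijection with the solutions of D = 0, so the system has finitely many solutions and the
-- Conjecture bounds them, hence the x_i, by f of the number of variables.

open import Defs
open import Data.Nat using (ℕ; zero; suc; _+_; _*_; _≤_; z≤n; s≤s)
open import Data.Fin using (Fin; zero; suc; #_; _↑ˡ_; _↑ʳ_)
import Data.Fin as Fin
open import Data.Vec using (Vec; []; _∷_; _++_; lookup)
import Data.Vec as Vec
open import Data.Nat.Properties
  using (≤-trans; n≤1+n; m≤m+n; m≤n+m; *-mono-≤; *-identityˡ; *-identityʳ; *-cancelˡ-≡; +-cancelʳ-≡)
open import Data.Nat.Tactic.RingSolver using (solve-∀)
open import Data.Vec.Properties using (lookup-++ˡ; lookup-++ʳ; lookup-splitAt; lookup-map)
open import Data.Vec.Relation.Unary.All as VAll using ([]; _∷_)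
import Data.Vec.Relation.Unary.All.Properties as VAllP
open import Data.List using (List; []; _∷_)
import Data.List as List
open import Data.List.Relation.Unary.All as All using (All; []; _∷_)
import Data.List.Relation.Unary.All.Properties as AllP
open import Data.List.Membership.Propositional using (_∈_)
open import Data.List.Membership.Propositional.Properties using (∈-map⁺)
open import Data.Product using (Σ; _,_; _×_; proj₁; proj₂)
open import Data.Sum using (inj₁; inj₂; [_,_]′)
open import Data.Integer as ℤ using (+_; -[1+_])
import Data.Integer.Properties as ℤP
import Data.Integer.Tactic.RingSolver as ℤSolver
open import Function using (id; _∘_)
open import Relation.Binary.PropositionalEquality
open ≡-Reasoning

sum-from-products : ∀ {u v z} → 1 ≤ z →
  z * z * (u * v + 1) + 1 ≡ (u * z + 1) * (v * z + 1) → z ≡ u + v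
sum-from-products {u} {v} {z@(suc _)} _ eq = *-cancelˡ-≡ z (u + v) z z*z≡z*[u+v]
  where
  c = z * z * (u * v) + 1
  expandˡ : ∀ u v z → z * z + (z * z * (u * v) + 1) ≡ z * z * (u * v + 1) + 1
  expandˡ = solve-∀
  expandʳ : ∀ u v z → (u * z + 1) * (v * z + 1) ≡ z * (u + v) + (z * z * (u * v) + 1)
  expandʳ = solve-∀
  z*z≡z*[u+v] : z * z ≡ z * (u + v)
  z*z≡z*[u+v] = +-cancelʳ-≡ c (z * z) (z * (u + v)) (begin
    z * z + c                  ≡⟨ expandˡ u v z ⟩
    z * z * (u * v + 1) + 1    ≡⟨ eq ⟩
    (u * z + 1) * (v * z + 1)  ≡⟨ expandʳ u v z ⟩
    z * (u + v) + c            ∎)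

Positive : ∀ {n} → Vec ℕ n → Set
Positive = VAll.All (1 ≤_)

Positive⇒map-suc : ∀ {n} {ys : Vec ℕ n} → Positive ys → Σ (Vec ℕ n) λ x → ys ≡ Vec.map suc x
Positive⇒map-suc [] = [] , refl
Positive⇒map-suc (s≤s z≤n ∷ pys) with Positive⇒map-suc pys
... | x , refl = _ ∷ x , refl

m*m≡m⇒m≡1 : ∀ {m} → 1 ≤ m → m * m ≡ m → m ≡ 1
m*m≡m⇒m≡1 {m@(suc _)} _ eq = *-cancelˡ-≡ m 1 m (trans eq (sym (*-identityʳ m)))

rename : ∀ {m n} → (Fin m → Fin n) → Eqn m → Eqn n
rename ρ (plus1 i k)   = plus1 (ρ i) (ρ k)
rename ρ (times i j k) = times (ρ i) (ρ j) (ρ k)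

module _ {m n} {w : Vec ℕ n} {w′ : Vec ℕ m} {ρ : Fin m → Fin n}
         (w∘ρ≗w′ : ∀ j → lookup w (ρ j) ≡ lookup w′ j) where

  Holds-rename : ∀ e → Holds w (rename ρ e) ≡ Holds w′ e
  Holds-rename (plus1 i k)   = cong₂ _≡_ (cong (_+ 1) (w∘ρ≗w′ i)) (w∘ρ≗w′ k)
  Holds-rename (times i j k) = cong₂ _≡_ (cong₂ _*_ (w∘ρ≗w′ i) (w∘ρ≗w′ j)) (w∘ρ≗w′ k)

  All-Holds-rename⁺ : ∀ {es} → All (Holds w′) es → All (Holds w) (List.map (rename ρ) es)
  All-Holds-rename⁺ = AllP.map⁺ ∘ All.map (λ {e} → subst id (sym (Holds-rename e)))

  All-Holds-rename⁻ : ∀ {es} → All (Holds w) (List.map (rename ρ) es) → All (Holds w′) es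
  All-Holds-rename⁻ = All.map (λ {e} → subst id (Holds-rename e)) ∘ AllP.map⁻

-- Encoding of a binary operation: with the operands in variables 0 and 1, the positive solutions
-- of the equations are exactly the extension by aux, one of whose entries is the value of op.
record Gadget : Set where
  field
    op           : ℕ → ℕ → ℕ
    width        : ℕ
    equations    : List (Eqn (2 + width))
    aux          : ℕ → ℕ → Vec ℕ width
    result       : Fin width
    aux-result   : ∀ u v → lookup (aux u v) result ≡ op u v
    aux-solves   : ∀ u v → All (Holds (u ∷ v ∷ aux u v)) equations
    aux-unique   : ∀ u v (w : Vec ℕ width) → Positive w → All (Holds (u ∷ v ∷ w)) equations → w ≡ aux u v
    aux-positive : ∀ {u v} → 1 ≤ u → 1 ≤ v → Positive (aux u v)

  op-positive : ∀ {u v} → 1 ≤ u → 1 ≤ v → 1 ≤ op u v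
  op-positive {u} {v} pu pv = subst (1 ≤_) (aux-result u v) (VAllP.lookup⁺ (aux-positive pu pv) result)

addition : Gadget
addition = record
  { op           = _+_
  ; width        = 10
  ; equations    = times (# 0) (# 2) (# 3) ∷ plus1 (# 3) (# 4) ∷ times (# 1) (# 2) (# 5) ∷ plus1 (# 5) (# 6) ∷
                   times (# 4) (# 6) (# 7) ∷ times (# 0) (# 1) (# 8) ∷ plus1 (# 8) (# 9) ∷
                   times (# 2) (# 2) (# 10) ∷ times (# 10) (# 9) (# 11) ∷ plus1 (# 11) (# 7) ∷ []
  ; aux          = aux
  ; result       = zero
  ; aux-result   = λ _ _ → refl
  ; aux-solves   = λ u v → refl ∷ refl ∷ refl ∷ refl ∷ refl ∷ refl ∷ refl ∷ refl ∷ refl ∷ identity u v ∷ []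
  ; aux-unique   = unique
  ; aux-positive = positive
  }
  where
  aux : ℕ → ℕ → Vec ℕ 10
  aux u v = z ∷ u * z ∷ u * z + 1 ∷ v * z ∷ v * z + 1 ∷ (u * z + 1) * (v * z + 1) ∷
            u * v ∷ u * v + 1 ∷ z * z ∷ z * z * (u * v + 1) ∷ []
    where z = u + v

  identity : ∀ u v → (u + v) * (u + v) * (u * v + 1) + 1 ≡ (u * (u + v) + 1) * (v * (u + v) + 1)
  identity = solve-∀

  unique : ∀ u v w → Positive w → All (Holds (u ∷ v ∷ w)) _ → w ≡ aux u v
  unique u v (z ∷ _ ∷ _ ∷ _ ∷ _ ∷ _ ∷ _ ∷ _ ∷ _ ∷ _ ∷ []) (pz ∷ _)
    (refl ∷ refl ∷ refl ∷ refl ∷ refl ∷ refl ∷ refl ∷ refl ∷ refl ∷ check ∷ [])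
    with sum-from-products {u} {v} pz check
  ... | refl = refl

  positive : ∀ {u v} → 1 ≤ u → 1 ≤ v → Positive (aux u v)
  positive {u} {v} pu pv =
    pz ∷ *-mono-≤ pu pz ∷ +1-positive ∷ *-mono-≤ pv pz ∷ +1-positive ∷
    *-mono-≤ (+1-positive {u * _}) (+1-positive {v * _}) ∷
    *-mono-≤ pu pv ∷ +1-positive ∷ *-mono-≤ pz pz ∷ *-mono-≤ (*-mono-≤ pz pz) +1-positive ∷ []
    where
    pz = ≤-trans pu (m≤m+n u v)
    +1-positive : ∀ {m} → 1 ≤ m + 1
    +1-positive {m} = m≤n+m 1 m

multiplication : Gadget
multiplication = record
  { op           = _*_
  ; width        = 1
  ; equations    = times (# 0) (# 1) (# 2) ∷ []
  ; aux          = λ u v → u * v ∷ []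
  ; result       = zero
  ; aux-result   = λ _ _ → refl
  ; aux-solves   = λ _ _ → refl ∷ []
  ; aux-unique   = λ { _ _ (_ ∷ []) _ (refl ∷ []) → refl }
  ; aux-positive = λ pu pv → *-mono-≤ pu pv ∷ []
  }

-- Variables of a system are G global variables followed by local ones, so a valuation is gs ++ ls.
module Layout (G : ℕ) where

  liftLocals : ∀ {s s′} → (Fin s → Fin s′) → Fin (G + s) → Fin (G + s′)
  liftLocals {s′ = s′} f j = [ _↑ˡ s′ , (λ r → G ↑ʳ f r) ]′ (Fin.splitAt G j)

  lookup-liftLocals : ∀ {s s′} (gs : Vec ℕ G) {ls : Vec ℕ s} {ls′ : Vec ℕ s′} {f : Fin s → Fin s′} →
    (∀ r → lookup ls′ (f r) ≡ lookup ls r) → ∀ j → lookup (gs ++ ls′) (liftLocals f j) ≡ lookup (gs ++ ls) j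
  lookup-liftLocals gs {ls} {ls′} {f} ls′∘f≗ls j rewrite lookup-splitAt G gs ls j with Fin.splitAt G j
  ... | inj₁ g = lookup-++ˡ gs ls′ g
  ... | inj₂ r = trans (lookup-++ʳ gs ls′ (f r)) (ls′∘f≗ls r)

  module Node (sa sb k : ℕ) where

    left : Fin (G + sa) → Fin (G + (sa + (sb + k)))
    left = liftLocals (_↑ˡ (sb + k))

    right : Fin (G + sb) → Fin (G + (sa + (sb + k)))
    right = liftLocals (λ r → sa ↑ʳ (r ↑ˡ k))

    own : Fin k → Fin (G + (sa + (sb + k)))
    own i = G ↑ʳ (sa ↑ʳ (sb ↑ʳ i))

    instantiate : Fin (G + sa) → Fin (G + sb) → Fin (2 + k) → Fin (G + (sa + (sb + k)))
    instantiate ia ib zero          = left ia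
    instantiate ia ib (suc zero)    = right ib
    instantiate ia ib (suc (suc i)) = own i

    combine : List (Eqn (G + sa)) → List (Eqn (G + sb)) → List (Eqn (G + (sa + (sb + k)))) →
      List (Eqn (G + (sa + (sb + k))))
    combine ea eb eo = List.map (rename left) ea List.++ List.map (rename right) eb List.++ eo

    module _ (gs : Vec ℕ G) (la : Vec ℕ sa) (lb : Vec ℕ sb) (lo : Vec ℕ k) where

      lookup-left : ∀ j → lookup (gs ++ (la ++ (lb ++ lo))) (left j) ≡ lookup (gs ++ la) j
      lookup-left = lookup-liftLocals gs (λ r → lookup-++ˡ la (lb ++ lo) r)

      lookup-right : ∀ j → lookup (gs ++ (la ++ (lb ++ lo))) (right j) ≡ lookup (gs ++ lb) j
      lookup-right = lookup-liftLocals gs (λ r → trans (lookup-++ʳ la (lb ++ lo) (r ↑ˡ k)) (lookup-++ˡ lb lo r))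

      lookup-own : ∀ i → lookup (gs ++ (la ++ (lb ++ lo))) (own i) ≡ lookup lo i
      lookup-own i = begin
        lookup (gs ++ (la ++ (lb ++ lo))) (own i)   ≡⟨ lookup-++ʳ gs _ (sa ↑ʳ (sb ↑ʳ i)) ⟩
        lookup (la ++ (lb ++ lo)) (sa ↑ʳ (sb ↑ʳ i)) ≡⟨ lookup-++ʳ la _ (sb ↑ʳ i) ⟩
        lookup (lb ++ lo) (sb ↑ʳ i)                 ≡⟨ lookup-++ʳ lb lo i ⟩
        lookup lo i                                 ∎

      lookup-instantiate : ∀ {ia ib u v} → lookup (gs ++ la) ia ≡ u → lookup (gs ++ lb) ib ≡ v →
        ∀ j → lookup (gs ++ (la ++ (lb ++ lo))) (instantiate ia ib j) ≡ lookup (u ∷ v ∷ lo) j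
      lookup-instantiate a≡u b≡v zero          = trans (lookup-left _) a≡u
      lookup-instantiate a≡u b≡v (suc zero)    = trans (lookup-right _) b≡v
      lookup-instantiate a≡u b≡v (suc (suc i)) = lookup-own i

      combine-holds⁺ : ∀ {ea eb eo} → All (Holds (gs ++ la)) ea → All (Holds (gs ++ lb)) eb →
        All (Holds (gs ++ (la ++ (lb ++ lo)))) eo → All (Holds (gs ++ (la ++ (lb ++ lo)))) (combine ea eb eo)
      combine-holds⁺ ha hb ho =
        AllP.++⁺ (All-Holds-rename⁺ lookup-left ha)
                 (AllP.++⁺ (All-Holds-rename⁺ lookup-right hb) ho)

      combine-holds⁻ : ∀ ea eb eo → All (Holds (gs ++ (la ++ (lb ++ lo)))) (combine ea eb eo) →
        All (Holds (gs ++ la)) ea × All (Holds (gs ++ lb)) eb × All (Holds (gs ++ (la ++ (lb ++ lo)))) eo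
      combine-holds⁻ ea eb eo h with AllP.++⁻ (List.map (rename left) ea) h
      ... | ha , h′ with AllP.++⁻ (List.map (rename right) eb) h′
      ... | hb , ho = All-Holds-rename⁻ lookup-left ha ,
                      All-Holds-rename⁻ lookup-right hb , ho

data Term (p : ℕ) : Set where
  one  : Term p
  var  : Fin p → Term p
  node : Gadget → Term p → Term p → Term p

-- Term variables stand for x_i + 1, so that all values are positive.
⟦_⟧ : ∀ {p} → Term p → Vec ℕ p → ℕ
⟦ one ⟧        x = 1
⟦ var i ⟧      x = suc (lookup x i)
⟦ node g a b ⟧ x = Gadget.op g (⟦ a ⟧ x) (⟦ b ⟧ x)

⟦⟧-positive : ∀ {p} (t : Term p) x → 1 ≤ ⟦ t ⟧ x
⟦⟧-positive one          x = s≤s z≤n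
⟦⟧-positive (var i)      x = s≤s z≤n
⟦⟧-positive (node g a b) x = Gadget.op-positive g (⟦⟧-positive a x) (⟦⟧-positive b x)

-- The global variables hold 1 and the x_i + 1; the locals of a node are those of its two subterms
-- followed by the auxiliary variables of its gadget.
module Compile (p : ℕ) where
  open Layout (suc p)
  open Gadget

  globals : Vec ℕ p → Vec ℕ (suc p)
  globals x = 1 ∷ Vec.map suc x

  globals-positive : ∀ x → Positive (globals x)
  globals-positive x = s≤s z≤n ∷ VAllP.map⁺ (VAll.universal (λ _ → s≤s z≤n) x)

  lookup-globals : ∀ {s} x (ls : Vec ℕ s) i → lookup (globals x ++ ls) (suc i ↑ˡ s) ≡ suc (lookup x i)
  lookup-globals x ls i = trans (lookup-++ˡ (Vec.map suc x) ls i) (lookup-map i suc x)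

  size : Term p → ℕ
  size one          = 0
  size (var i)      = 0
  size (node g a b) = size a + (size b + width g)

  output : (t : Term p) → Fin (suc p + size t)
  output one          = zero ↑ˡ 0
  output (var i)      = suc i ↑ˡ 0
  output (node g a b) = Node.own (size a) (size b) (width g) (result g)

  equationsOf : (t : Term p) → List (Eqn (suc p + size t))
  equationsOf one          = []
  equationsOf (var i)      = []
  equationsOf (node g a b) =
    combine (equationsOf a) (equationsOf b) (List.map (rename (instantiate (output a) (output b))) (equations g))
    where open Node (size a) (size b) (width g)

  locals : (t : Term p) → Vec ℕ p → Vec ℕ (size t)
  locals one          x = []
  locals (var i)      x = []
  locals (node g a b) x = locals a x ++ (locals b x ++ aux g (⟦ a ⟧ x) (⟦ b ⟧ x))

  lookup-output : ∀ t x → lookup (globals x ++ locals t x) (output t) ≡ ⟦ t ⟧ x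
  lookup-output one          x = refl
  lookup-output (var i)      x = lookup-globals x [] i
  lookup-output (node g a b) x =
    trans (Node.lookup-own (size a) (size b) (width g) (globals x) (locals a x) (locals b x) _ (result g))
          (aux-result g _ _)

  locals-positive : ∀ t x → Positive (locals t x)
  locals-positive one          x = []
  locals-positive (var i)      x = []
  locals-positive (node g a b) x =
    VAllP.++⁺ (locals-positive a x)
      (VAllP.++⁺ (locals-positive b x) (aux-positive g (⟦⟧-positive a x) (⟦⟧-positive b x)))

  locals-solve : ∀ t x → All (Holds (globals x ++ locals t x)) (equationsOf t)
  locals-solve one          x = []
  locals-solve (var i)      x = []
  locals-solve (node g a b) x =
    combine-holds⁺ (globals x) (locals a x) (locals b x) _ (locals-solve a x) (locals-solve b x)
      (All-Holds-rename⁺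
        (lookup-instantiate (globals x) (locals a x) (locals b x) _ (lookup-output a x) (lookup-output b x))
        (aux-solves g _ _))
    where open Node (size a) (size b) (width g)

  locals-unique : ∀ t x ls → Positive ls → All (Holds (globals x ++ ls)) (equationsOf t) → ls ≡ locals t x
  locals-unique one          x [] _ _ = refl
  locals-unique (var i)      x [] _ _ = refl
  locals-unique (node g a b) x ls pls h
    with Vec.splitAt (size a) ls
  ... | la , lbo , refl with Vec.splitAt (size b) lbo
  ... | lb , lo , refl
    with Node.combine-holds⁻ (size a) (size b) (width g) (globals x) la lb lo _ _ _ h | VAllP.++⁻ la pls
  ... | ha , hb , ho | pla , plbo with VAllP.++⁻ lb plbo
  ... | plb , plo with locals-unique a x la pla ha | locals-unique b x lb plb hb
  ... | refl | refl =
    cong (λ lo → locals a x ++ (locals b x ++ lo))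
      (aux-unique g _ _ lo plo
        (All-Holds-rename⁻ (lookup-instantiate (globals x) la lb lo (lookup-output a x) (lookup-output b x)) ho))
    where open Node (size a) (size b) (width g)

  -- The equations u * u = u and u * P = Q pin the first global variable u to 1 and impose P = Q.
  module System (P Q : Term p) where
    open Node (size P) (size Q) 0

    variables : ℕ
    variables = suc p + (size P + (size Q + 0))

    unit : Fin variables
    unit = Fin.zero {p} ↑ˡ (size P + (size Q + 0))

    closing : List (Eqn variables)
    closing = times unit unit unit ∷ times unit (left (output P)) (right (output Q)) ∷ []

    system : List (Eqn variables)
    system = combine (equationsOf P) (equationsOf Q) closing

    canonical : Vec ℕ p → Vec ℕ variables
    canonical x = globals x ++ (locals P x ++ (locals Q x ++ []))

    lookup-canonical-P : ∀ x → lookup (canonical x) (left (output P)) ≡ ⟦ P ⟧ x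
    lookup-canonical-P x =
      trans (lookup-left (globals x) (locals P x) (locals Q x) [] (output P)) (lookup-output P x)

    lookup-canonical-Q : ∀ x → lookup (canonical x) (right (output Q)) ≡ ⟦ Q ⟧ x
    lookup-canonical-Q x =
      trans (lookup-right (globals x) (locals P x) (locals Q x) [] (output Q)) (lookup-output Q x)

    canonical-solves : ∀ x → ⟦ P ⟧ x ≡ ⟦ Q ⟧ x → PosSolution system (canonical x)
    canonical-solves x P≡Q = VAllP.lookup⁺ positive , combine-holds⁺ (globals x) (locals P x) (locals Q x) []
      (locals-solve P x) (locals-solve Q x) (refl ∷ equal ∷ [])
      where
      positive : Positive (canonical x)
      positive = VAllP.++⁺ (globals-positive x)
        (VAllP.++⁺ (locals-positive P x) (VAllP.++⁺ (locals-positive Q x) []))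
      equal : 1 * lookup (canonical x) (left (output P)) ≡ lookup (canonical x) (right (output Q))
      equal = begin
        1 * lookup (canonical x) (left (output P)) ≡⟨ *-identityˡ _ ⟩
        lookup (canonical x) (left (output P))     ≡⟨ lookup-canonical-P x ⟩
        ⟦ P ⟧ x                                    ≡⟨ P≡Q ⟩
        ⟦ Q ⟧ x                                    ≡⟨ lookup-canonical-Q x ⟨
        lookup (canonical x) (right (output Q))    ∎

    solution-canonical : ∀ s → PosSolution system s →
      Σ (Vec ℕ p) λ x → ⟦ P ⟧ x ≡ ⟦ Q ⟧ x × s ≡ canonical x
    solution-canonical s (ps , h) with Vec.splitAt (suc p) s
    ... | u ∷ ys , l , refl with Vec.splitAt (size P) l
    ... | lP , lQ′ , refl with Vec.splitAt (size Q) lQ′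
    ... | lQ , [] , refl
      with VAllP.++⁻ (u ∷ ys) (VAllP.lookup⁻ ps)
         | combine-holds⁻ (u ∷ ys) lP lQ [] (equationsOf P) (equationsOf Q) closing h
    ... | pu ∷ pys , pl | hP , hQ , u*u≡u ∷ P≡Q ∷ [] with m*m≡m⇒m≡1 pu u*u≡u | Positive⇒map-suc pys
    ... | refl | x , refl with VAllP.++⁻ lP pl
    ... | plP , plQ with locals-unique P x lP plP hP | locals-unique Q x lQ (proj₁ (VAllP.++⁻ lQ plQ)) hQ
    ... | refl | refl = x , equal , refl
      where
      equal : ⟦ P ⟧ x ≡ ⟦ Q ⟧ x
      equal = begin
        ⟦ P ⟧ x                                    ≡⟨ lookup-canonical-P x ⟨
        lookup (canonical x) (left (output P))     ≡⟨ *-identityˡ _ ⟨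
        1 * lookup (canonical x) (left (output P)) ≡⟨ P≡Q ⟩
        lookup (canonical x) (right (output Q))    ≡⟨ lookup-canonical-Q x ⟩
        ⟦ Q ⟧ x                                    ∎

module _ {p : ℕ} where

  infixl 6 _⊞_
  infixl 7 _⊠_

  _⊞_ _⊠_ : Term p → Term p → Term p
  _⊞_ = node addition
  _⊠_ = node multiplication

  numeral : ℕ → Term p
  numeral zero    = one
  numeral (suc n) = one ⊞ numeral n

  ⟦numeral⟧ : ∀ n x → ⟦ numeral n ⟧ x ≡ suc n
  ⟦numeral⟧ zero    x = refl
  ⟦numeral⟧ (suc n) x = cong suc (⟦numeral⟧ n x)

  difference : Poly p → Term p × Term p
  difference (const (+ n))    = numeral n , one
  difference (const -[1+ n ]) = one , numeral (suc n)
  difference (var i)          = var i , one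
  difference (a ⊕ b) = let a⁺ , a⁻ = difference a ; b⁺ , b⁻ = difference b in
    a⁺ ⊞ b⁺ , a⁻ ⊞ b⁻
  difference (a ⊗ b) = let a⁺ , a⁻ = difference a ; b⁺ , b⁻ = difference b in
    a⁺ ⊠ b⁺ ⊞ a⁻ ⊠ b⁻ , a⁺ ⊠ b⁻ ⊞ a⁻ ⊠ b⁺

  ⟦_⟧⁺ ⟦_⟧⁻ : Poly p → Vec ℕ p → ℕ
  ⟦ D ⟧⁺ = ⟦ proj₁ (difference D) ⟧
  ⟦ D ⟧⁻ = ⟦ proj₂ (difference D) ⟧

  eval-difference : ∀ D x → eval D x ≡ + ⟦ D ⟧⁺ x ℤ.- + ⟦ D ⟧⁻ x
  eval-difference (const (+ n))    x = cong (λ m → + m ℤ.- + 1) (sym (⟦numeral⟧ n x))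
  eval-difference (const -[1+ n ]) x = cong (λ m → + 1 ℤ.- + m) (sym (⟦numeral⟧ (suc n) x))
  eval-difference (var i)          x = refl
  eval-difference (a ⊕ b)          x = begin
    eval a x ℤ.+ eval b x                          ≡⟨ cong₂ ℤ._+_ (eval-difference a x) (eval-difference b x) ⟩
    (+ A⁺ ℤ.- + A⁻) ℤ.+ (+ B⁺ ℤ.- + B⁻)            ≡⟨ sum-of-differences (+ A⁺) (+ A⁻) (+ B⁺) (+ B⁻) ⟩
    (+ A⁺ ℤ.+ + B⁺) ℤ.- (+ A⁻ ℤ.+ + B⁻)            ∎
    where
    A⁺ = ⟦ a ⟧⁺ x ; A⁻ = ⟦ a ⟧⁻ x ; B⁺ = ⟦ b ⟧⁺ x ; B⁻ = ⟦ b ⟧⁻ x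
    sum-of-differences : ∀ a b c d → (a ℤ.- b) ℤ.+ (c ℤ.- d) ≡ (a ℤ.+ c) ℤ.- (b ℤ.+ d)
    sum-of-differences = ℤSolver.solve-∀
  eval-difference (a ⊗ b)          x = begin
    eval a x ℤ.* eval b x
      ≡⟨ cong₂ ℤ._*_ (eval-difference a x) (eval-difference b x) ⟩
    (+ A⁺ ℤ.- + A⁻) ℤ.* (+ B⁺ ℤ.- + B⁻)
      ≡⟨ product-of-differences (+ A⁺) (+ A⁻) (+ B⁺) (+ B⁻) ⟩
    (+ A⁺ ℤ.* + B⁺ ℤ.+ + A⁻ ℤ.* + B⁻) ℤ.- (+ A⁺ ℤ.* + B⁻ ℤ.+ + A⁻ ℤ.* + B⁺)
      ≡⟨ cong₂ (λ m n → m ℤ.- n) (pos-*+* A⁺ B⁺ A⁻ B⁻) (pos-*+* A⁺ B⁻ A⁻ B⁺) ⟩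
    + ⟦ a ⊗ b ⟧⁺ x ℤ.- + ⟦ a ⊗ b ⟧⁻ x
      ∎
    where
    A⁺ = ⟦ a ⟧⁺ x ; A⁻ = ⟦ a ⟧⁻ x ; B⁺ = ⟦ b ⟧⁺ x ; B⁻ = ⟦ b ⟧⁻ x
    product-of-differences : ∀ a b c d → (a ℤ.- b) ℤ.* (c ℤ.- d) ≡ (a ℤ.* c ℤ.+ b ℤ.* d) ℤ.- (a ℤ.* d ℤ.+ b ℤ.* c)
    product-of-differences = ℤSolver.solve-∀
    pos-*+* : ∀ m n k l → + m ℤ.* + n ℤ.+ + k ℤ.* + l ≡ + (m * n + k * l)
    pos-*+* m n k l = sym (cong₂ ℤ._+_ (ℤP.pos-* m n) (ℤP.pos-* k l))

  Root⇒⟦⟧⁺≡⟦⟧⁻ : ∀ D x → Root D x → ⟦ D ⟧⁺ x ≡ ⟦ D ⟧⁻ x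
  Root⇒⟦⟧⁺≡⟦⟧⁻ D x root = ℤP.+-injective (ℤP.i-j≡0⇒i≡j _ _ (trans (sym (eval-difference D x)) root))

  ⟦⟧⁺≡⟦⟧⁻⇒Root : ∀ D x → ⟦ D ⟧⁺ x ≡ ⟦ D ⟧⁻ x → Root D x
  ⟦⟧⁺≡⟦⟧⁻⇒Root D x eq = begin
    eval D x                          ≡⟨ eval-difference D x ⟩
    + ⟦ D ⟧⁺ x ℤ.- + ⟦ D ⟧⁻ x         ≡⟨ cong (λ m → + m ℤ.- + ⟦ D ⟧⁻ x) eq ⟩
    + ⟦ D ⟧⁻ x ℤ.- + ⟦ D ⟧⁻ x         ≡⟨ ℤP.+-inverseʳ (+ ⟦ D ⟧⁻ x) ⟩
    + 0                               ∎

FinitelyMany-image : ∀ {m n} {A : Vec ℕ m → Set} {B : Vec ℕ n → Set} (h : Vec ℕ m → Vec ℕ n) →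
  (∀ s → B s → Σ (Vec ℕ m) λ x → A x × s ≡ h x) → FinitelyMany A → FinitelyMany B
FinitelyMany-image h covered (L , complete) = List.map h L , λ s Bs →
  let x , Ax , s≡hx = covered s Bs in subst (_∈ List.map h L) (sym s≡hx) (∈-map⁺ h (complete x Ax))

module Reduction {p : ℕ} (D : Poly p) where
  open Compile p
  private module S = System (proj₁ (difference D)) (proj₂ (difference D))
  open S public using (variables; system; canonical)

  canonical-solves-root : ∀ x → Root D x → PosSolution system (canonical x)
  canonical-solves-root x root = S.canonical-solves x (Root⇒⟦⟧⁺≡⟦⟧⁻ D x root)

  system-finite : FinitelyMany (Root D) → FinitelyMany (PosSolution system)
  system-finite = FinitelyMany-image canonical λ s sol →
    let x , eq , s≡ = S.solution-canonical s sol in x , ⟦⟧⁺≡⟦⟧⁻⇒Root D x eq , s≡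

corollary1 : Conjecture →
    Σ ((p : ℕ) → Poly p → ℕ) λ g →
      (p : ℕ) (D : Poly p) → FinitelyMany (Root D) →
      (x : Vec ℕ p) → Root D x → (i : Fin p) → lookup x i ≤ g p D
corollary1 conjecture = (λ p D → f (variables D)) , bounded
  where
  open Reduction
  bounded : (p : ℕ) (D : Poly p) → FinitelyMany (Root D) →
    (x : Vec ℕ p) → Root D x → (i : Fin p) → lookup x i ≤ f (variables D)
  bounded p D finite x root i =
    ≤-trans (n≤1+n _) (subst (_≤ f (variables D)) (Compile.lookup-globals p x _ i) canonical-bounded)
    where
    canonical-bounded : lookup (canonical D x) (suc i ↑ˡ _) ≤ f (variables D)
    canonical-bounded = conjecture (variables D) (s≤s z≤n) (system D) (system-finite D finite)
      (canonical D x) (canonical-solves-root D x root) (suc i ↑ˡ _)
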